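{- Let $\mathbb{C}_1,\dots,\mathbb{C}_n$ and $\mathbb{D}$ be comonads on categories $\mathcal{C}_1,\dots,\mathcal{C}_n$ and $\mathcal{D}$, each base category carrying a proper factorisation system and each comonad preserving embeddings, such that each of $\mathrm{EM}(\mathbb{C}_1),\dots,\mathrm{EM}(\mathbb{C}_n),\mathrm{EM}(\mathbb{D})$ is a path category (with the lifted factorisation system and some chosen class of paths) and $\mathrm{EM}(\mathbb{D})$ has equalisers. Let $H\colon\prod_i\mathcal{C}_i\to\mathcal{D}$ be a functor preserving embeddings, and suppose there is a Kleisli law $\kappa\colon\mathbb{D}\circ H\Rightarrow H\circ\prod_i\mathbb{C}_i$ satisfying (S2''): for every path $(P,\pi)$ in $\mathrm{EM}(\mathbb{D})$ and coalgebras $(A_i,\alpha_i)\in\mathrm{EM}(\mathbb{C}_i)$, every bimorphism $f\colon\pi\to[\vec\alpha]$ decomposes as $f=H(e_1,\dots,e_n)\circ f_0$ for some $f_0\colon P\to H(P_1,\dots,P_n)$ and some path embeddings $e_i\colon(P_i,\pi_i)\rightarrowtail(A_i,\alpha_i)$ in $\mathrm{EM}(\mathbb{C}_i)$. Then for all objects $A_i,B_i\in\mathcal{C}_i$, $$A_1\rightarrow^{e}_{\mathbb{C}_1}B_1,\ \dots,\ A_n\rightarrow^{e}_{\mathbb{C}_n}B_n\quad\text{implies}\quad H(A_1,\dots,A_n)\rightarrow^{e}_{\mathbb{D}}H(B_1,\dots,B_n).$$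
   Context: Comonad $(\mathbb{C},\varepsilon,\delta)$; coalgebras $(A,\alpha)$ with $\varepsilon_A\circ\alpha=\mathrm{id}$, $\delta_A\circ\alpha=\mathbb{C}(\alpha)\circ\alpha$; coalgebra morphisms; category $\mathrm{EM}(\mathbb{C})$; cofree coalgebra $F^{\mathbb{C}}(A)=(\mathbb{C}A,\delta_A)$. A proper factorisation system $(\mathcal{E},\mathcal{M})$: every morphism factors as $m\circ e$, the two classes are each other's weak-orthogonality classes, $\mathcal{E}$ epis, $\mathcal{M}$ monos; members of $\mathcal{M}$ are embeddings. Preserving embeddings: sending (tuples of) embeddings to embeddings. For $\mathbb{C}$ preserving embeddings, a coalgebra morphism is an embedding/quotient in the lifted system iff its underlying morphism is. A path category is a category with a proper factorisation system and a chosen class of path objects; a path embedding is an embedding with path domain; $f\colon X\to Y$ is a pathwise-embedding if $f\circ e$ is an embedding for all path embeddings $e$ into $X$. Write $A\rightarrow^{e}_{\mathbb{C}}B$ if there is a pathwise-embedding $F^{\mathbb{C}}(A)\to F^{\mathbb{C}}(B)$ in $\mathrm{EM}(\mathbb{C})$. A Kleisli law is a natural $\kappa$ with components $\kappa_{\vec A}\colon\mathbb{D}H(\vec A)\to H(\mathbb{C}_1A_1,\dots,\mathbb{C}_nA_n)$ with $H(\varepsilon_{A_1},\dots)\circ\kappa=\varepsilon_H$ and $H(\delta_{A_1},\dots)\circ\kappa_{\vec A}=\kappa_{\mathbb{C}\vec A}\circ\mathbb{D}(\kappa_{\vec A})\circ\delta_{H(\vec A)}$. A bimorphism $\alpha\to[\vec\beta]$,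 for a $\mathbb{D}$-coalgebra $(A,\alpha)$ and $\mathbb{C}_i$-coalgebras $(B_i,\beta_i)$, is $g\colon A\to H(\vec B)$ with $H(\beta_1,\dots,\beta_n)\circ g=\kappa_{\vec B}\circ\mathbb{D}(g)\circ\alpha$. -}

module Defs where

open import Level using (Level; _⊔_) renaming (suc to lsuc)
open import Data.Nat using (ℕ)
open import Data.Fin using (Fin)
open import Data.Product using (Σ; _×_; _,_; proj₁; proj₂)
open import Function.Bundles using (_⇔_)
open import Relation.Binary using (Rel; IsEquivalence)

private
  variable
    o ℓ e o' ℓ' e' p : Level

record Category (o ℓ e : Level) : Set (lsuc (o ⊔ ℓ ⊔ e)) where
  infix  4 _≈_
  infixr 9 _∘_
  field
    Obj       : Set o
    Hom       : Obj → Obj → Set ℓ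
    _≈_       : ∀ {A B} → Rel (Hom A B) e
    id        : ∀ {A} → Hom A A
    _∘_       : ∀ {A B C} → Hom B C → Hom A B → Hom A C
    equiv     : ∀ {A B} → IsEquivalence (_≈_ {A} {B})
    ∘-resp-≈  : ∀ {A B C} {f h : Hom B C} {g i : Hom A B} →
                f ≈ h → g ≈ i → f ∘ g ≈ h ∘ i
    identityˡ : ∀ {A B} {f : Hom A B} → id ∘ f ≈ f
    identityʳ : ∀ {A B} {f : Hom A B} → f ∘ id ≈ f
    assoc     : ∀ {A B C D} {f : Hom A B} {g : Hom B C} {h : Hom C D} →
                (h ∘ g) ∘ f ≈ h ∘ (g ∘ f)

  module Eq {A B} = IsEquivalence (equiv {A} {B})

record Functor (C : Category o ℓ e) (D : Category o' ℓ' e')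
       : Set (o ⊔ ℓ ⊔ e ⊔ o' ⊔ ℓ' ⊔ e') where
  private
    module C = Category C
    module D = Category D
  field
    F₀           : C.Obj → D.Obj
    F₁           : ∀ {A B} → C.Hom A B → D.Hom (F₀ A) (F₀ B)
    identity     : ∀ {A} → F₁ (C.id {A}) D.≈ D.id
    homomorphism : ∀ {A B X} {f : C.Hom A B} {g : C.Hom B X} →
                   F₁ (g C.∘ f) D.≈ F₁ g D.∘ F₁ f
    F-resp-≈     : ∀ {A B} {f g : C.Hom A B} → f C.≈ g → F₁ f D.≈ F₁ g

Π : {n : ℕ} → (Fin n → Category o ℓ e) → Category o ℓ e
Π {n = n} C = record
  { Obj       = (i : Fin n) → Category.Obj (C i)
  ; Hom       = λ A B → (i : Fin n) → Category.Hom (C i) (A i) (B i)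
  ; _≈_       = λ f g → (i : Fin n) → Category._≈_ (C i) (f i) (g i)
  ; id        = λ i → Category.id (C i)
  ; _∘_       = λ f g i → Category._∘_ (C i) (f i) (g i)
  ; equiv     = record
      { refl  = λ i → Category.Eq.refl (C i)
      ; sym   = λ p i → Category.Eq.sym (C i) (p i)
      ; trans = λ p q i → Category.Eq.trans (C i) (p i) (q i) }
  ; ∘-resp-≈  = λ p q i → Category.∘-resp-≈ (C i) (p i) (q i)
  ; identityˡ = λ i → Category.identityˡ (C i)
  ; identityʳ = λ i → Category.identityʳ (C i)
  ; assoc     = λ i → Category.assoc (C i)
  }

record Comonad (C : Category o ℓ e) : Set (o ⊔ ℓ ⊔ e) where
  open Category C
  field
    F : Functor C C
  open Functor F public
  field
    ε       : ∀ A → Hom (F₀ A) A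
    δ       : ∀ A → Hom (F₀ A) (F₀ (F₀ A))
    ε-natural : ∀ {A B} (f : Hom A B) → f ∘ ε A ≈ ε B ∘ F₁ f
    δ-natural : ∀ {A B} (f : Hom A B) → F₁ (F₁ f) ∘ δ A ≈ δ B ∘ F₁ f
    identityˡ-law : ∀ {A} → ε (F₀ A) ∘ δ A ≈ id
    identityʳ-law : ∀ {A} → F₁ (ε A) ∘ δ A ≈ id
    assoc-law     : ∀ {A} → δ (F₀ A) ∘ δ A ≈ F₁ (δ A) ∘ δ A

module _ {C : Category o ℓ e} (G : Comonad C) where
  open Category C
  open Comonad G using (F₀; F₁; ε; δ)

  record Coalg : Set (o ⊔ ℓ ⊔ e) where
    constructor coalg
    field
      carrier : Obj
      α       : Hom carrier (F₀ carrier)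
      counit  : ε carrier ∘ α ≈ id
      coassoc : δ carrier ∘ α ≈ F₁ α ∘ α

  record CoalgHom (X Y : Coalg) : Set (ℓ ⊔ e) where
    constructor coalgHom
    private
      module X = Coalg X
      module Y = Coalg Y
    field
      arr     : Hom X.carrier Y.carrier
      commute : Y.α ∘ arr ≈ F₁ arr ∘ X.α

open Coalg public
open CoalgHom public

module _ {C : Category o ℓ e} (G : Comonad C) where
  open Category C
  open Comonad G using (F₀; F₁; ε; δ; homomorphism; identity)
  open Category.Eq C

  EM : Category (o ⊔ ℓ ⊔ e) (ℓ ⊔ e) e
  EM = record
    { Obj       = Coalg G
    ; Hom       = CoalgHom G
    ; _≈_       = λ f g → arr f ≈ arr g
    ; id        = λ {X} → coalgHom id
        (trans identityʳ (trans (sym identityˡ)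
          (∘-resp-≈ (sym identity) refl)))
    ; _∘_       = λ {X} {Y} {Z} g f → coalgHom (arr g ∘ arr f)
        (trans (sym assoc)
        (trans (∘-resp-≈ (commute g) refl)
        (trans assoc
        (trans (∘-resp-≈ refl (commute f))
        (trans (sym assoc)
               (∘-resp-≈ (sym homomorphism) refl))))))
    ; equiv     = record { refl = refl ; sym = sym ; trans = trans }
    ; ∘-resp-≈  = ∘-resp-≈
    ; identityˡ = identityˡ
    ; identityʳ = identityʳ
    ; assoc     = assoc
    }

  cofree : Obj → Coalg G
  cofree A = coalg (F₀ A) (δ A) (Comonad.identityˡ-law G) (Comonad.assoc-law G)

module _ (C : Category o ℓ e) where
  open Category C

  _⧄_ : ∀ {A B X Y} → Hom A B → Hom X Y → Set (ℓ ⊔ e)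
  _⧄_ {A} {B} {X} {Y} q m =
    (u : Hom A X) (v : Hom B Y) → m ∘ u ≈ v ∘ q →
    Σ (Hom B X) λ d → (d ∘ q ≈ u) × (m ∘ d ≈ v)

  IsEpi : ∀ {A B} → Hom A B → Set (o ⊔ ℓ ⊔ e)
  IsEpi {A} {B} q = ∀ {Z} (g h : Hom B Z) → g ∘ q ≈ h ∘ q → g ≈ h

  IsMono : ∀ {A B} → Hom A B → Set (o ⊔ ℓ ⊔ e)
  IsMono {A} {B} m = ∀ {Z} (g h : Hom Z A) → m ∘ g ≈ m ∘ h → g ≈ h

  record IsProperFactorisationSystem
         (𝓔 𝓜 : ∀ {A B} → Hom A B → Set p) : Set (o ⊔ ℓ ⊔ e ⊔ p) where
    field
      factorise : ∀ {A B} (f : Hom A B) →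
        Σ Obj λ Z → Σ (Hom A Z) λ q → Σ (Hom Z B) λ m →
          𝓔 q × 𝓜 m × (f ≈ m ∘ q)
      𝓔-is-⧄𝓜 : ∀ {A B} (q : Hom A B) →
        𝓔 q ⇔ (∀ {X Y} (m : Hom X Y) → 𝓜 m → q ⧄ m)
      𝓜-is-𝓔⧄ : ∀ {X Y} (m : Hom X Y) →
        𝓜 m ⇔ (∀ {A B} (q : Hom A B) → 𝓔 q → q ⧄ m)
      𝓔-epi  : ∀ {A B} (q : Hom A B) → 𝓔 q → IsEpi q
      𝓜-mono : ∀ {A B} (m : Hom A B) → 𝓜 m → IsMono m

  HasEqualisers : Set (o ⊔ ℓ ⊔ e)
  HasEqualisers = ∀ {A B} (f g : Hom A B) →
    Σ Obj λ E → Σ (Hom E A) λ q → (f ∘ q ≈ g ∘ q) ×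
      (∀ {Z} (h : Hom Z A) → f ∘ h ≈ g ∘ h →
        Σ (Hom Z E) λ u → (q ∘ u ≈ h) × (∀ (u' : Hom Z E) → q ∘ u' ≈ h → u' ≈ u))

  IsPathwiseEmbedding : (𝓜 : ∀ {A B} → Hom A B → Set p) (Path : Obj → Set p) →
    ∀ {X Y} → Hom X Y → Set (o ⊔ ℓ ⊔ p)
  IsPathwiseEmbedding 𝓜 Path {X} f =
    ∀ {P} → Path P → (m : Hom P X) → 𝓜 m → 𝓜 (f ∘ m)

module _ {C : Category o ℓ e} (G : Comonad C) where
  lift : (∀ {A B} → Category.Hom C A B → Set p) →
         ∀ {X Y} → CoalgHom G X Y → Set p
  lift 𝓚 f = 𝓚 (arr f)

  -- A →ᵉ_ℂ B : a pathwise-embedding F^ℂ(A) → F^ℂ(B) in EM(ℂ)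
  -- (w.r.t. the lifted embeddings and the chosen paths of EM(ℂ))
  PathwiseEmbeds : (𝓜 : ∀ {A B} → Category.Hom C A B → Set p)
                   (Path : Coalg G → Set p) →
                   Category.Obj C → Category.Obj C → Set (o ⊔ ℓ ⊔ e ⊔ p)
  PathwiseEmbeds 𝓜 Path A B =
    Σ (CoalgHom G (cofree G A) (cofree G B))
      (IsPathwiseEmbedding (EM G) (lift 𝓜) Path)

module _ {n : ℕ} {C : Fin n → Category o ℓ e} (CC : (i : Fin n) → Comonad (C i))
         {D : Category o' ℓ' e'} (DD : Comonad D) (H : Functor (Π C) D) where
  private
    open Category D
    module H = Functor H
    module DD = Comonad DD
    module CC (i : Fin n) = Comonad (CC i)
    ∏ℂ₀ : Category.Obj (Π C) → Category.Obj (Π C)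
    ∏ℂ₀ A i = CC.F₀ i (A i)

  record KleisliLaw : Set (o ⊔ ℓ ⊔ e ⊔ o' ⊔ ℓ' ⊔ e') where
    field
      κ : ∀ A → Hom (DD.F₀ (H.F₀ A)) (H.F₀ (∏ℂ₀ A))
      natural : ∀ {A B} (f : Category.Hom (Π C) A B) →
        H.F₁ (λ i → CC.F₁ i (f i)) ∘ κ A ≈ κ B ∘ DD.F₁ (H.F₁ f)
      counit : ∀ A → H.F₁ (λ i → CC.ε i (A i)) ∘ κ A ≈ DD.ε (H.F₀ A)
      comult : ∀ A → H.F₁ (λ i → CC.δ i (A i)) ∘ κ A
                     ≈ κ (∏ℂ₀ A) ∘ (DD.F₁ (κ A) ∘ DD.δ (H.F₀ A))

  IsBimorphism : KleisliLaw → (X : Coalg DD) (Bs : (i : Fin n) → Coalg (CC i)) →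
    Hom (carrier X) (H.F₀ (λ i → carrier (Bs i))) → Set e'
  IsBimorphism K X Bs g =
    H.F₁ (λ i → α (Bs i)) ∘ g ≈ KleisliLaw.κ K (λ i → carrier (Bs i)) ∘ (DD.F₁ g ∘ α X)

  S2'' : KleisliLaw →
         (𝓜C : (i : Fin n) → ∀ {A B} → Category.Hom (C i) A B → Set p) →
         (PathC : (i : Fin n) → Coalg (CC i) → Set p) →
         (PathD : Coalg DD → Set p) → Set (o ⊔ ℓ ⊔ e ⊔ o' ⊔ ℓ' ⊔ e' ⊔ p)
  S2'' K 𝓜C PathC PathD =
    ∀ (P : Coalg DD) → PathD P → (As : (i : Fin n) → Coalg (CC i)) →
    (f : Hom (carrier P) (H.F₀ (λ i → carrier (As i)))) → IsBimorphism K P As f →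
    Σ ((i : Fin n) → Coalg (CC i)) λ Ps → ((i : Fin n) → PathC i (Ps i)) ×
    Σ ((i : Fin n) → CoalgHom (CC i) (Ps i) (As i)) λ es →
      ((i : Fin n) → 𝓜C i (arr (es i))) ×
    Σ (Hom (carrier P) (H.F₀ (λ i → carrier (Ps i)))) λ f₀ →
      f ≈ H.F₁ (λ i → arr (es i)) ∘ f₀

{-# OPTIONS --safe #-}
-- The family f of coalgebra morphisms ℂAᵢ → ℂBᵢ lifts through κ to the coextension
-- g of H(ε ∘ f) ∘ κ_A : 𝔻HA → HB, and κ_B ∘ g = H f ∘ κ_A. For a path embedding
-- m : P ↣ 𝔻HA the map κ_A ∘ m is a bimorphism, so (S2'') splits it as H e ∘ f₀ with
-- path embeddings eᵢ. A coalgebra morphism into a cofree coalgebra is the coextension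
-- of its composite with ε; hence m = 𝔻H(ε ∘ e) ∘ f₀♯, making f₀♯ an embedding, and
-- κ_B♯ ∘ g ∘ m = 𝔻H(f ∘ e) ∘ f₀♯, an embedding because f is pathwise. Cancelling κ_B♯
-- shows that g ∘ m is an embedding. Only the factorisation system on 𝒟, preservation
-- of embeddings by 𝔻 and H, and (S2'') are used.
module Submission where

open import Defs
open import Level using (Level; _⊔_)
open import Data.Nat using (ℕ)
open import Data.Fin using (Fin)
open import Data.Product using (_,_; proj₁; proj₂)
open import Function.Bundles using (Equivalence)
open import Relation.Binary.Bundles using (Setoid)
import Relation.Binary.Reasoning.Setoid as SetoidReasoning

module CategoryReasoning {o ℓ e} (𝒞 : Category o ℓ e) where
  open Category 𝒞 public
  open Eq public

  hom-setoid : Obj → Obj → Setoid ℓ e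
  hom-setoid A B = record { Carrier = Hom A B ; _≈_ = _≈_ ; isEquivalence = equiv }

  module HomReasoning {A B : Obj} = SetoidReasoning (hom-setoid A B)
  open HomReasoning public

  infixr 4 _⟩∘⟨_ refl⟩∘⟨_
  infixl 5 _⟩∘⟨refl

  _⟩∘⟨_ : ∀ {A B C} {f h : Hom B C} {g i : Hom A B} → f ≈ h → g ≈ i → f ∘ g ≈ h ∘ i
  _⟩∘⟨_ = ∘-resp-≈

  refl⟩∘⟨_ : ∀ {A B C} {f : Hom B C} {g i : Hom A B} → g ≈ i → f ∘ g ≈ f ∘ i
  refl⟩∘⟨ p = ∘-resp-≈ refl p

  _⟩∘⟨refl : ∀ {A B C} {f h : Hom B C} {g : Hom A B} → f ≈ h → f ∘ g ≈ h ∘ g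
  p ⟩∘⟨refl = ∘-resp-≈ p refl

module Embeddings {o ℓ e p} {𝒞 : Category o ℓ e}
  {𝓔 𝓜 : ∀ {A B} → Category.Hom 𝒞 A B → Set p}
  (fs : IsProperFactorisationSystem 𝒞 𝓔 𝓜) where
  open CategoryReasoning 𝒞
  open IsProperFactorisationSystem fs
  open Equivalence

  𝓜-resp-≈ : ∀ {A B} {m m' : Hom A B} → m ≈ m' → 𝓜 m → 𝓜 m'
  𝓜-resp-≈ {m = m} {m'} m≈m' m∈𝓜 = from (𝓜-is-𝓔⧄ m') λ q q∈𝓔 u v square →
    let d , d∘q≈u , m∘d≈v =
          to (𝓜-is-𝓔⧄ m) m∈𝓜 q q∈𝓔 u v (trans (m≈m' ⟩∘⟨refl) square)
    in d , d∘q≈u , trans (sym m≈m' ⟩∘⟨refl) m∘d≈v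

  𝓜-∘ : ∀ {A B C} {m : Hom B C} {m' : Hom A B} → 𝓜 m → 𝓜 m' → 𝓜 (m ∘ m')
  𝓜-∘ {m = m} {m'} m∈𝓜 m'∈𝓜 = from (𝓜-is-𝓔⧄ (m ∘ m')) λ q q∈𝓔 u v square →
    let d , d∘q≈m'∘u , m∘d≈v =
          to (𝓜-is-𝓔⧄ m) m∈𝓜 q q∈𝓔 (m' ∘ u) v (trans (sym assoc) square)
        d' , d'∘q≈u , m'∘d'≈d =
          to (𝓜-is-𝓔⧄ m') m'∈𝓜 q q∈𝓔 u d (sym d∘q≈m'∘u)
    in d' , d'∘q≈u , trans assoc (trans (refl⟩∘⟨ m'∘d'≈d) m∘d≈v)

  𝓜-cancelˡ : ∀ {A B C} (m : Hom B C) {m' : Hom A B} → 𝓜 (m ∘ m') → 𝓜 m'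
  𝓜-cancelˡ m {m'} m∘m'∈𝓜 = from (𝓜-is-𝓔⧄ m') λ q q∈𝓔 u v square →
    let d , d∘q≈u , _ =
          to (𝓜-is-𝓔⧄ (m ∘ m')) m∘m'∈𝓜 q q∈𝓔 u (m ∘ v)
            (trans assoc (trans (refl⟩∘⟨ square) (sym assoc)))
    in d , d∘q≈u ,
       𝓔-epi q q∈𝓔 (m' ∘ d) v (trans assoc (trans (refl⟩∘⟨ d∘q≈u) square))

module Coextension {o ℓ e} {𝒞 : Category o ℓ e} (G : Comonad 𝒞) where
  open CategoryReasoning 𝒞
  private module G = Comonad G

  coextend : (X : Coalg G) {B : Obj} → Hom (carrier X) B → Hom (carrier X) (G.F₀ B)
  coextend X k = G.F₁ k ∘ α X

  coextend-coalgHom : (X : Coalg G) {B : Obj} → Hom (carrier X) B → CoalgHom G X (cofree G B)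
  coextend-coalgHom X {B} k = coalgHom (coextend X k) (begin
    G.δ B ∘ (G.F₁ k ∘ α X)                  ≈⟨ sym assoc ⟩
    (G.δ B ∘ G.F₁ k) ∘ α X                  ≈⟨ sym (G.δ-natural k) ⟩∘⟨refl ⟩
    (G.F₁ (G.F₁ k) ∘ G.δ (carrier X)) ∘ α X ≈⟨ assoc ⟩
    G.F₁ (G.F₁ k) ∘ (G.δ (carrier X) ∘ α X) ≈⟨ refl⟩∘⟨ coassoc X ⟩
    G.F₁ (G.F₁ k) ∘ (G.F₁ (α X) ∘ α X)      ≈⟨ sym assoc ⟩
    (G.F₁ (G.F₁ k) ∘ G.F₁ (α X)) ∘ α X      ≈⟨ sym G.homomorphism ⟩∘⟨refl ⟩
    G.F₁ (G.F₁ k ∘ α X) ∘ α X               ∎)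

  ε∘coextend : (X : Coalg G) {B : Obj} (k : Hom (carrier X) B) → G.ε B ∘ coextend X k ≈ k
  ε∘coextend X {B} k = begin
    G.ε B ∘ (G.F₁ k ∘ α X)          ≈⟨ sym assoc ⟩
    (G.ε B ∘ G.F₁ k) ∘ α X          ≈⟨ sym (G.ε-natural k) ⟩∘⟨refl ⟩
    (k ∘ G.ε (carrier X)) ∘ α X     ≈⟨ assoc ⟩
    k ∘ (G.ε (carrier X) ∘ α X)     ≈⟨ refl⟩∘⟨ counit X ⟩
    k ∘ id                          ≈⟨ identityʳ ⟩
    k                               ∎

  coalgHom-cofree-η : {X : Coalg G} {B : Obj} (m : CoalgHom G X (cofree G B)) →
                      arr m ≈ coextend X (G.ε B ∘ arr m)
  coalgHom-cofree-η {X} {B} m = begin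
    arr m                               ≈⟨ sym identityˡ ⟩
    id ∘ arr m                          ≈⟨ sym G.identityʳ-law ⟩∘⟨refl ⟩
    (G.F₁ (G.ε B) ∘ G.δ B) ∘ arr m      ≈⟨ assoc ⟩
    G.F₁ (G.ε B) ∘ (G.δ B ∘ arr m)      ≈⟨ refl⟩∘⟨ commute m ⟩
    G.F₁ (G.ε B) ∘ (G.F₁ (arr m) ∘ α X) ≈⟨ sym assoc ⟩
    (G.F₁ (G.ε B) ∘ G.F₁ (arr m)) ∘ α X ≈⟨ sym G.homomorphism ⟩∘⟨refl ⟩
    G.F₁ (G.ε B ∘ arr m) ∘ α X          ∎

  coalgHom-cofree-factor : {X : Coalg G} {Y B : Obj} (m : CoalgHom G X (cofree G B))
    (k : Hom Y B) (j : Hom (carrier X) Y) →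
    G.ε B ∘ arr m ≈ k ∘ j → arr m ≈ G.F₁ k ∘ coextend X j
  coalgHom-cofree-factor {X} {B = B} m k j ε∘m≈k∘j = begin
    arr m                        ≈⟨ coalgHom-cofree-η m ⟩
    G.F₁ (G.ε B ∘ arr m) ∘ α X   ≈⟨ G.F-resp-≈ ε∘m≈k∘j ⟩∘⟨refl ⟩
    G.F₁ (k ∘ j) ∘ α X           ≈⟨ G.homomorphism ⟩∘⟨refl ⟩
    (G.F₁ k ∘ G.F₁ j) ∘ α X      ≈⟨ assoc ⟩
    G.F₁ k ∘ (G.F₁ j ∘ α X)      ∎

module KleisliLift {o ℓ e o' ℓ' e'} {n : ℕ} {C : Fin n → Category o ℓ e}
  (CC : (i : Fin n) → Comonad (C i)) {D : Category o' ℓ' e'} (DD : Comonad D)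
  (H : Functor (Π C) D) (K : KleisliLaw CC DD H) where
  open CategoryReasoning D
  open Coextension DD
  private
    module 𝔻 = Comonad DD
    module ℍ = Functor H
    module 𝕂 = KleisliLaw K
    module ℂ (i : Fin n) = Comonad (CC i)
    module ΠC = Category (Π C)

  ℂ₀ : ΠC.Obj → ΠC.Obj
  ℂ₀ A i = ℂ.F₀ i (A i)

  ℂ₁ : ∀ {A B} → ΠC.Hom A B → ΠC.Hom (ℂ₀ A) (ℂ₀ B)
  ℂ₁ f i = ℂ.F₁ i (f i)

  ℂε : (A : ΠC.Obj) → ΠC.Hom (ℂ₀ A) A
  ℂε A i = ℂ.ε i (A i)

  ℂδ : (A : ΠC.Obj) → ΠC.Hom (ℂ₀ A) (ℂ₀ (ℂ₀ A))
  ℂδ A i = ℂ.δ i (A i)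

  CofreeHoms : ΠC.Obj → ΠC.Obj → Set (ℓ ⊔ e)
  CofreeHoms A B = (i : Fin n) → CoalgHom (CC i) (cofree (CC i) (A i)) (cofree (CC i) (B i))

  arrs : {Xs Ys : (i : Fin n) → Coalg (CC i)} → ((i : Fin n) → CoalgHom (CC i) (Xs i) (Ys i)) →
         ΠC.Hom (λ i → carrier (Xs i)) (λ i → carrier (Ys i))
  arrs f i = arr (f i)

  cofreeLift : ∀ {A B} → CofreeHoms A B →
               CoalgHom DD (cofree DD (ℍ.F₀ A)) (cofree DD (ℍ.F₀ B))
  cofreeLift {A} {B} f =
    coextend-coalgHom (cofree DD (ℍ.F₀ A)) (ℍ.F₁ (ℂε B ΠC.∘ arrs f) ∘ 𝕂.κ A)

  κ∘cofreeLift : ∀ {A B} (f : CofreeHoms A B) →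
                 𝕂.κ B ∘ arr (cofreeLift f) ≈ ℍ.F₁ (arrs f) ∘ 𝕂.κ A
  κ∘cofreeLift {A} {B} f = begin
    𝕂.κ B ∘ (𝔻.F₁ (ℍ.F₁ εf ∘ 𝕂.κ A) ∘ δHA)
      ≈⟨ refl⟩∘⟨ (𝔻.homomorphism ⟩∘⟨refl) ⟩
    𝕂.κ B ∘ ((𝔻.F₁ (ℍ.F₁ εf) ∘ 𝔻.F₁ (𝕂.κ A)) ∘ δHA)
      ≈⟨ refl⟩∘⟨ assoc ⟩
    𝕂.κ B ∘ (𝔻.F₁ (ℍ.F₁ εf) ∘ (𝔻.F₁ (𝕂.κ A) ∘ δHA))
      ≈⟨ sym assoc ⟩
    (𝕂.κ B ∘ 𝔻.F₁ (ℍ.F₁ εf)) ∘ (𝔻.F₁ (𝕂.κ A) ∘ δHA)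
      ≈⟨ sym (𝕂.natural εf) ⟩∘⟨refl ⟩
    (ℍ.F₁ (ℂ₁ εf) ∘ 𝕂.κ (ℂ₀ A)) ∘ (𝔻.F₁ (𝕂.κ A) ∘ δHA)
      ≈⟨ assoc ⟩
    ℍ.F₁ (ℂ₁ εf) ∘ (𝕂.κ (ℂ₀ A) ∘ (𝔻.F₁ (𝕂.κ A) ∘ δHA))
      ≈⟨ refl⟩∘⟨ sym (𝕂.comult A) ⟩
    ℍ.F₁ (ℂ₁ εf) ∘ (ℍ.F₁ (ℂδ A) ∘ 𝕂.κ A)
      ≈⟨ sym assoc ⟩
    (ℍ.F₁ (ℂ₁ εf) ∘ ℍ.F₁ (ℂδ A)) ∘ 𝕂.κ A
      ≈⟨ sym ℍ.homomorphism ⟩∘⟨refl ⟩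
    ℍ.F₁ (ℂ₁ εf ΠC.∘ ℂδ A) ∘ 𝕂.κ A
      ≈⟨ ℍ.F-resp-≈ (λ i → Category.Eq.sym (C i)
                       (Coextension.coalgHom-cofree-η (CC i) (f i))) ⟩∘⟨refl ⟩
    ℍ.F₁ (arrs f) ∘ 𝕂.κ A
      ∎
    where
      εf = ℂε B ΠC.∘ arrs f
      δHA = 𝔻.δ (ℍ.F₀ A)

  κ∘coalgHom-isBimorphism : ∀ {X : Coalg DD} {A} (m : CoalgHom DD X (cofree DD (ℍ.F₀ A))) →
    IsBimorphism CC DD H K X (λ i → cofree (CC i) (A i)) (𝕂.κ A ∘ arr m)
  κ∘coalgHom-isBimorphism {X} {A} m = begin
    ℍ.F₁ (ℂδ A) ∘ (𝕂.κ A ∘ arr m)                       ≈⟨ sym assoc ⟩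
    (ℍ.F₁ (ℂδ A) ∘ 𝕂.κ A) ∘ arr m                       ≈⟨ 𝕂.comult A ⟩∘⟨refl ⟩
    (𝕂.κ (ℂ₀ A) ∘ (𝔻.F₁ (𝕂.κ A) ∘ 𝔻.δ _)) ∘ arr m       ≈⟨ assoc ⟩
    𝕂.κ (ℂ₀ A) ∘ ((𝔻.F₁ (𝕂.κ A) ∘ 𝔻.δ _) ∘ arr m)       ≈⟨ refl⟩∘⟨ assoc ⟩
    𝕂.κ (ℂ₀ A) ∘ (𝔻.F₁ (𝕂.κ A) ∘ (𝔻.δ _ ∘ arr m))       ≈⟨ refl⟩∘⟨ refl⟩∘⟨ commute m ⟩
    𝕂.κ (ℂ₀ A) ∘ (𝔻.F₁ (𝕂.κ A) ∘ (𝔻.F₁ (arr m) ∘ α X))  ≈⟨ refl⟩∘⟨ sym assoc ⟩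
    𝕂.κ (ℂ₀ A) ∘ ((𝔻.F₁ (𝕂.κ A) ∘ 𝔻.F₁ (arr m)) ∘ α X)  ≈⟨ refl⟩∘⟨ (sym 𝔻.homomorphism ⟩∘⟨refl) ⟩
    𝕂.κ (ℂ₀ A) ∘ (𝔻.F₁ (𝕂.κ A ∘ arr m) ∘ α X)           ∎

  module _ {p} {𝓔D 𝓜D : ∀ {X Y} → Hom X Y → Set p}
    (fsD : IsProperFactorisationSystem D 𝓔D 𝓜D)
    (𝔻-preserves-𝓜 : ∀ {X Y} (f : Hom X Y) → 𝓜D f → 𝓜D (𝔻.F₁ f))
    {𝓜C : (i : Fin n) → ∀ {X Y} → Category.Hom (C i) X Y → Set p}
    (H-preserves-𝓜 : ∀ {X Y} (f : ΠC.Hom X Y) → ((i : Fin n) → 𝓜C i (f i)) → 𝓜D (ℍ.F₁ f))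
    {PathC : (i : Fin n) → Coalg (CC i) → Set p} {PathD : Coalg DD → Set p}
    (s2 : S2'' CC DD H K 𝓜C PathC PathD) where
    open Embeddings fsD

    cofreeLift-isPathwiseEmbedding : ∀ {A B} (f : CofreeHoms A B) →
      ((i : Fin n) → IsPathwiseEmbedding (EM (CC i)) (lift (CC i) (𝓜C i)) (PathC i) (f i)) →
      IsPathwiseEmbedding (EM DD) (lift DD 𝓜D) PathD (cofreeLift f)
    cofreeLift-isPathwiseEmbedding {A} {B} f f-pathwise {P} P-path m m∈𝓜
      with s2 P P-path (λ i → cofree (CC i) (A i)) (𝕂.κ A ∘ arr m) (κ∘coalgHom-isBimorphism m)
    ... | Ps , Ps-path , e , e∈𝓜 , f₀ , κ∘m≈He∘f₀ =
      𝓜-cancelˡ (arr κ♯) (𝓜-resp-≈ (sym κ♯∘lift∘m-factors) (𝓜-∘ 𝔻H[f∘e]∈𝓜 f₀♯∈𝓜))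
      where
        module EMD = Category (EM DD)

        through-e : ∀ {Y} (φ : ΠC.Hom (ℂ₀ A) Y) →
                    ℍ.F₁ φ ∘ (𝕂.κ A ∘ arr m) ≈ ℍ.F₁ (φ ΠC.∘ arrs e) ∘ f₀
        through-e φ = begin
          ℍ.F₁ φ ∘ (𝕂.κ A ∘ arr m)          ≈⟨ refl⟩∘⟨ κ∘m≈He∘f₀ ⟩
          ℍ.F₁ φ ∘ (ℍ.F₁ (arrs e) ∘ f₀)     ≈⟨ sym assoc ⟩
          (ℍ.F₁ φ ∘ ℍ.F₁ (arrs e)) ∘ f₀     ≈⟨ sym ℍ.homomorphism ⟩∘⟨refl ⟩
          ℍ.F₁ (φ ΠC.∘ arrs e) ∘ f₀         ∎

        f₀♯ : Hom (carrier P) (𝔻.F₀ (ℍ.F₀ (λ i → carrier (Ps i))))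
        f₀♯ = coextend P f₀

        m-factors : arr m ≈ 𝔻.F₁ (ℍ.F₁ (ℂε A ΠC.∘ arrs e)) ∘ f₀♯
        m-factors = coalgHom-cofree-factor m _ f₀ (begin
          𝔻.ε _ ∘ arr m                          ≈⟨ sym (𝕂.counit A) ⟩∘⟨refl ⟩
          (ℍ.F₁ (ℂε A) ∘ 𝕂.κ A) ∘ arr m          ≈⟨ assoc ⟩
          ℍ.F₁ (ℂε A) ∘ (𝕂.κ A ∘ arr m)          ≈⟨ through-e (ℂε A) ⟩
          ℍ.F₁ (ℂε A ΠC.∘ arrs e) ∘ f₀           ∎)

        f₀♯∈𝓜 : 𝓜D f₀♯
        f₀♯∈𝓜 = 𝓜-cancelˡ _ (𝓜-resp-≈ m-factors m∈𝓜)

        κ♯ : CoalgHom DD (cofree DD (ℍ.F₀ B)) (cofree DD (ℍ.F₀ (ℂ₀ B)))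
        κ♯ = coextend-coalgHom (cofree DD (ℍ.F₀ B)) (𝕂.κ B)

        κ♯∘lift∘m-factors :
          arr (κ♯ EMD.∘ (cofreeLift f EMD.∘ m)) ≈ 𝔻.F₁ (ℍ.F₁ (arrs f ΠC.∘ arrs e)) ∘ f₀♯
        κ♯∘lift∘m-factors = coalgHom-cofree-factor (κ♯ EMD.∘ (cofreeLift f EMD.∘ m)) _ f₀ (begin
          𝔻.ε _ ∘ (arr κ♯ ∘ (arr (cofreeLift f) ∘ arr m))
            ≈⟨ sym assoc ⟩
          (𝔻.ε _ ∘ arr κ♯) ∘ (arr (cofreeLift f) ∘ arr m)
            ≈⟨ ε∘coextend (cofree DD (ℍ.F₀ B)) (𝕂.κ B) ⟩∘⟨refl ⟩
          𝕂.κ B ∘ (arr (cofreeLift f) ∘ arr m)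
            ≈⟨ sym assoc ⟩
          (𝕂.κ B ∘ arr (cofreeLift f)) ∘ arr m
            ≈⟨ κ∘cofreeLift f ⟩∘⟨refl ⟩
          (ℍ.F₁ (arrs f) ∘ 𝕂.κ A) ∘ arr m
            ≈⟨ assoc ⟩
          ℍ.F₁ (arrs f) ∘ (𝕂.κ A ∘ arr m)
            ≈⟨ through-e (arrs f) ⟩
          ℍ.F₁ (arrs f ΠC.∘ arrs e) ∘ f₀
            ∎)

        𝔻H[f∘e]∈𝓜 : 𝓜D (𝔻.F₁ (ℍ.F₁ (arrs f ΠC.∘ arrs e)))
        𝔻H[f∘e]∈𝓜 = 𝔻-preserves-𝓜 _ (H-preserves-𝓜 _ λ i → f-pathwise i (Ps-path i) (e i) (e∈𝓜 i))

theorem7p1 : ∀ {o ℓ e o' ℓ' e' p : Level} {n : ℕ}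
      -- comonads ℂ_i on 𝒞_i, with proper factorisation systems (𝓔_i, 𝓜_i)
      (C : Fin n → Category o ℓ e) (CC : (i : Fin n) → Comonad (C i))
      (𝓔C 𝓜C : (i : Fin n) → ∀ {A B} → Category.Hom (C i) A B → Set p) →
      ((i : Fin n) → IsProperFactorisationSystem (C i) (𝓔C i) (𝓜C i)) →
      -- ℂ_i preserves embeddings
      ((i : Fin n) → ∀ {A B} (f : Category.Hom (C i) A B) →
        𝓜C i f → 𝓜C i (Comonad.F₁ (CC i) f)) →
      -- EM(ℂ_i) is a path category with the lifted factorisation system
      (PathC : (i : Fin n) → Coalg (CC i) → Set p) →
      ((i : Fin n) → IsProperFactorisationSystem (EM (CC i))
                       (lift (CC i) (𝓔C i)) (lift (CC i) (𝓜C i))) →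
      -- comonad 𝔻 on 𝒟, with proper factorisation system (𝓔, 𝓜)
      (D : Category o' ℓ' e') (DD : Comonad D)
      (𝓔D 𝓜D : ∀ {A B} → Category.Hom D A B → Set p) →
      IsProperFactorisationSystem D 𝓔D 𝓜D →
      (∀ {A B} (f : Category.Hom D A B) → 𝓜D f → 𝓜D (Comonad.F₁ DD f)) →
      -- EM(𝔻) is a path category with the lifted factorisation system, and has equalisers
      (PathD : Coalg DD → Set p) →
      IsProperFactorisationSystem (EM DD) (lift DD 𝓔D) (lift DD 𝓜D) →
      HasEqualisers (EM DD) →
      -- H : ∏ 𝒞_i → 𝒟 preserving embeddings
      (H : Functor (Π C) D) →
      (∀ {A B} (f : Category.Hom (Π C) A B) →
        ((i : Fin n) → 𝓜C i (f i)) → 𝓜D (Functor.F₁ H f)) →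
      -- Kleisli law κ satisfying (S2'')
      (K : KleisliLaw CC DD H) →
      S2'' CC DD H K 𝓜C PathC PathD →
      -- conclusion
      (A B : Category.Obj (Π C)) →
      ((i : Fin n) → PathwiseEmbeds (CC i) (𝓜C i) (PathC i) (A i) (B i)) →
      PathwiseEmbeds DD 𝓜D PathD (Functor.F₀ H A) (Functor.F₀ H B)
theorem7p1 C CC _ 𝓜C _ _ PathC _ D DD _ _ fsD 𝔻-preserves-𝓜 _ _ _ H H-preserves-𝓜 K s2 A B A→B =
  cofreeLift f ,
  cofreeLift-isPathwiseEmbedding fsD 𝔻-preserves-𝓜 {𝓜C} H-preserves-𝓜 {PathC} s2 f
    (λ i → proj₂ (A→B i))
  where
    open KleisliLift CC DD H K
    f : CofreeHoms A B
    f i = proj₁ (A→B i)
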